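{- Let $r_{n,m}$ be the number of horizontally decorated paths ending at $(n,m)$. Then \[ r_{n,m}=r_{n,m-1}+(m+1)\,r_{n-1,m}\ \text{ for } n,m\ge1,\ n\ge m;\qquad r_{n,m}=0\ \text{ for } n<m;\qquad r_{n,0}=1\ \text{ for } n\ge0. \] Moreover, the number of relaxed binary trees of size $n$ equals $r_{n,n}$.
   Context: A horizontally decorated path is a lattice path starting at $(0,0)$ with steps $H=(1,0)$ and $V=(0,1)$ confined to $0\le y\le x$, where each $H$ step is decorated by a number in $\{1,\dots,k+1\}$, $k$ being its $y$-coordinate. A relaxed binary tree of size $n$ is a DAG obtained from a binary tree with $n$ internal nodes (the spine) by keeping the left-most leaf and turning every other leaf into a pointer to a node (internal node or left-most leaf) preceding that leaf in postorder of the spine. -}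

module Defs where

open import Data.Nat using (ℕ; zero; suc; _≤_; _<ᵇ_; _≡ᵇ_)
open import Data.Fin using (Fin)
open import Data.Bool using (Bool; true; false; _∧_; _∨_; T)
open import Data.List using (List; []; _∷_; _++_; length)
open import Data.Product using (Σ; _×_)
open import Relation.Binary.PropositionalEquality using (_≡_)

-- HDPath x y = lattice paths from (0,0) to (x,y) with steps H=(1,0),
-- V=(0,1), staying in 0 ≤ y ≤ x, each H step decorated by an element of
-- {1,…,k+1} (represented by Fin (suc k)) where k is the y-coordinate of
-- that H step.

data HDPath : ℕ → ℕ → Set where
  start : HDPath 0 0
  stepH : ∀ {x y} → HDPath x y → Fin (suc y) → HDPath (suc x) y
  stepV : ∀ {x y} → HDPath x y → suc y ≤ x → HDPath x (suc y)

-- A binary tree (the spine) whose leaves carry the extra information: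
-- `lf` is a plain leaf (allowed only as the left-most leaf) and
-- `ptr j` is a leaf turned into a pointer to the node at position j
-- (0-based) in the postorder traversal of the spine (leaves included).

data DTree : Set where
  lf   : DTree
  ptr  : ℕ → DTree
  node : DTree → DTree → DTree

size : DTree → ℕ
size lf         = 0
size (ptr _)    = 0
size (node l r) = suc (size l Data.Nat.+ size r)

data Node : Set where
  lfN  : Node
  ptrN : ℕ → Node
  intN : Node

post : DTree → List Node
post lf         = lfN ∷ []
post (ptr j)    = ptrN j ∷ []
post (node l r) = post l ++ post r ++ intN ∷ []

isInternalAt : List Node → ℕ → Bool
isInternalAt []           _       = false
isInternalAt (intN ∷ _)   zero    = true
isInternalAt (_ ∷ _)      zero    = false
isInternalAt (_ ∷ ps)     (suc j) = isInternalAt ps j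

legalTarget : List Node → ℕ → Bool
legalTarget ps j = (j ≡ᵇ 0) ∨ isInternalAt ps j

-- check every entry of the postorder list `rest`, which starts at
-- position i of the full list `ps`
checkFrom : List Node → ℕ → List Node → Bool
checkFrom ps i []                = true
checkFrom ps zero (lfN ∷ rest)   = checkFrom ps 1 rest
checkFrom ps zero (_ ∷ rest)     = false
checkFrom ps (suc i) (lfN ∷ rest)    = false
checkFrom ps (suc i) (intN ∷ rest)   = checkFrom ps (suc (suc i)) rest
checkFrom ps (suc i) (ptrN j ∷ rest) =
  (j <ᵇ suc i) ∧ legalTarget ps j ∧ checkFrom ps (suc (suc i)) rest

valid : DTree → Bool
valid t = checkFrom (post t) 0 (post t)

RelaxedTree : ℕ → Set
RelaxedTree n = Σ DTree (λ t → (size t ≡ n) × T (valid t))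

module Submission where

-- Decomposing a decorated path by its last step (a V step, possible
-- only below the diagonal, or an H step carrying one of y+1
-- decorations) gives a bijection  Fin (r x y) ↔ HDPath x y,  and the
-- three arithmetic properties of r are immediate from its definition.
--
-- Part 2.  A relaxed tree is read through its postorder word.  The
-- validity test of the tree becomes a left-to-right condition on that
-- word, and the prefixes satisfying it are described by an inductive
-- family  Prefix w (1+x) y  (x pointer leaves, y internal nodes).
-- (a) A decorated path to (x , y) is the same as such a prefix: a V step
--     appends an internal node, an H step with decoration d appends a
--     pointer to the d-th of the y+1 legal targets (the left-most leaf
--     and the y internal nodes read so far).
-- (b) A prefix with n pointers and n internal nodes is exactly the
--     postorder word of a relaxed tree of size n (prefixes are stacks of
--     trees; the complete ones are a single tree).
-- Composing  Fin (r n n) ↔ HDPath n n ↔ Prefixes n n ↔ RelaxedTree n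
-- gives the last claim.

open import Defs
open import Data.Nat using (ℕ; zero; suc; _+_; _*_; _∸_; _≤_; _<_; _≤ᵇ_; _<ᵇ_; _≡ᵇ_; z≤n; s≤s; s≤s⁻¹)
open import Data.Nat.Properties
open import Data.Nat.Tactic.RingSolver using (solve-∀)
open import Data.Fin using (Fin) renaming (zero to fzero; suc to fsuc)
open import Data.Fin.Properties using (1↔⊤; +↔⊎; *↔×)
open import Data.Bool using (Bool; true; false; if_then_else_; T; _∧_; _∨_)
open import Data.Bool.Properties using (T-irrelevant; T-≡; ∧-assoc; ∧-identityʳ; ∨-zeroʳ)
open import Data.List using (List; []; _∷_; _++_; length)
open import Data.List.Properties using (++-assoc; ++-identityʳ; length-++)
open import Data.Maybe using (Maybe; just; nothing)
open import Data.Product using (Σ; _×_; _,_; proj₁; proj₂)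
open import Data.Sum using (_⊎_; inj₁; inj₂)
open import Data.Unit using (⊤; tt)
open import Data.Empty using (⊥-elim)
open import Function using (_∘_)
open import Function.Bundles using (_↔_; mk↔ₛ′; Inverse; Equivalence)
open import Function.Properties.Inverse using (↔-refl; ↔-trans)
open import Data.Sum.Function.Propositional using (_⊎-↔_)
open import Data.Product.Function.NonDependent.Propositional using (_×-↔_)
open import Relation.Nullary using (yes; no)
open import Relation.Nullary.Reflects using (ofʸ; ofⁿ)
open import Relation.Binary.PropositionalEquality

-- Part 1: the counting function and decorated paths

-- r x y, defined by the recurrence; the V term is present iff y+1 ≤ x+1.
r : ℕ → ℕ → ℕ
r zero    zero    = 1
r zero    (suc y) = 0
r (suc x) zero    = r x zero
r (suc x) (suc y) = (if y ≤ᵇ x then r (suc x) y else 0) + suc (suc y) * r x (suc y)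

paths-origin : Fin 1 ↔ HDPath 0 0
paths-origin = mk↔ₛ′ (λ _ → start) (λ _ → fzero) (λ { start → refl }) (λ { fzero → refl ; (fsuc ()) })

paths-vertical-axis : ∀ y → Fin 0 ↔ HDPath 0 (suc y)
paths-vertical-axis y = mk↔ₛ′ (λ ()) (λ { (stepV _ ()) }) (λ { (stepV _ ()) }) (λ ())

-- On the horizontal axis every H step has the single decoration 1.
paths-horizontal-axis : ∀ x → HDPath x 0 ↔ HDPath (suc x) 0
paths-horizontal-axis x = mk↔ₛ′ (λ p → stepH p fzero) dropH (λ { (stepH p fzero) → refl }) (λ _ → refl)
  where
  dropH : HDPath (suc x) 0 → HDPath x 0
  dropH (stepH p fzero) = p

LastStep : ℕ → ℕ → Set
LastStep x y = ((suc y ≤ suc x) × HDPath (suc x) y) ⊎ (Fin (suc (suc y)) × HDPath x (suc y))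

paths-last-step : ∀ x y → LastStep x y ↔ HDPath (suc x) (suc y)
paths-last-step x y = mk↔ₛ′ append split (λ { (stepH _ _) → refl ; (stepV _ _) → refl }) split-append
  where
  append : LastStep x y → HDPath (suc x) (suc y)
  append (inj₁ (le , p)) = stepV p le
  append (inj₂ (d , p))  = stepH p d
  split : HDPath (suc x) (suc y) → LastStep x y
  split (stepV p le) = inj₁ (le , p)
  split (stepH p d)  = inj₂ (d , p)
  split-append : ∀ q → split (append q) ≡ q
  split-append (inj₁ _) = refl
  split-append (inj₂ _) = refl

guarded : ∀ {n} {A : Set} x y → Fin n ↔ A → Fin (if y ≤ᵇ x then n else 0) ↔ ((suc y ≤ suc x) × A)
guarded {A = A} x y count with y ≤ᵇ x | ≤ᵇ-reflects-≤ y x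
... | true  | ofʸ y≤x = ↔-trans count
  (mk↔ₛ′ (s≤s y≤x ,_) proj₂ (λ { (le , a) → cong (_, a) (≤-irrelevant (s≤s y≤x) le) }) (λ _ → refl))
... | false | ofⁿ y≰x = mk↔ₛ′ (λ ()) impossible (λ q → ⊥-elim (impossible q)) (λ ())
  where
  impossible : ∀ {B : Set} → (suc y ≤ suc x) × A → B
  impossible (s≤s y≤x , _) = ⊥-elim (y≰x y≤x)

r-counts : ∀ x y → Fin (r x y) ↔ HDPath x y
r-counts zero    zero    = paths-origin
r-counts zero    (suc y) = paths-vertical-axis y
r-counts (suc x) zero    = ↔-trans (r-counts x zero) (paths-horizontal-axis x)
r-counts (suc x) (suc y) =
  ↔-trans +↔⊎ (↔-trans (guarded x y (r-counts (suc x) y) ⊎-↔ ↔-trans *↔× (↔-refl ×-↔ r-counts x (suc y)))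
                       (paths-last-step x y))

-- Below the diagonal the guard holds (the false case is refuted by ≤⇒≤ᵇ).
r-recurrence : ∀ n m → 1 ≤ n → 1 ≤ m → m ≤ n → r n m ≡ r n (m ∸ 1) + (m + 1) * r (n ∸ 1) m
r-recurrence (suc x) (suc y) _ _ (s≤s y≤x) with y ≤ᵇ x | ≤⇒≤ᵇ y≤x
... | true | _ = cong (λ k → r (suc x) y + k * r x (suc y)) (+-comm 1 (suc y))

-- Above the diagonal the guard fails and the H term vanishes by induction.
r-zero-above-diagonal : ∀ n m → n < m → r n m ≡ 0
r-zero-above-diagonal zero    (suc y) _ = refl
r-zero-above-diagonal (suc x) (suc y) (s≤s x<y) with y ≤ᵇ x | ≤ᵇ-reflects-≤ y x
... | true  | ofʸ y≤x = ⊥-elim (<⇒≱ x<y y≤x)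
... | false | _ rewrite r-zero-above-diagonal x (suc y) (m≤n⇒m≤1+n x<y) = *-zeroʳ (suc (suc y))

r-horizontal-axis : ∀ n → r n 0 ≡ 1
r-horizontal-axis zero    = refl
r-horizontal-axis (suc n) = r-horizontal-axis n

-- Part 2: postorder words

-- Words are snoc-lists of nodes, so that a postorder is read left to right.
infixl 7 _▷_
data Word : Set where
  ε   : Word
  _▷_ : Word → Node → Word

len : Word → ℕ
len ε       = 0
len (w ▷ _) = suc (len w)

toList : Word → List Node
toList ε       = []
toList (w ▷ x) = toList w ++ x ∷ []

infixl 6 _⊕_
_⊕_ : Word → Word → Word
v ⊕ ε       = v
v ⊕ (w ▷ x) = (v ⊕ w) ▷ x

postWord : DTree → Word
postWord lf         = ε ▷ lfN
postWord (ptr j)    = ε ▷ ptrN j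
postWord (node l r) = (postWord l ⊕ postWord r) ▷ intN

⊕-assoc : ∀ u v w → u ⊕ (v ⊕ w) ≡ (u ⊕ v) ⊕ w
⊕-assoc u v ε       = refl
⊕-assoc u v (w ▷ x) = cong (_▷ x) (⊕-assoc u v w)

ε-⊕ : ∀ w → ε ⊕ w ≡ w
ε-⊕ ε       = refl
ε-⊕ (w ▷ x) = cong (_▷ x) (ε-⊕ w)

toList-⊕ : ∀ v w → toList (v ⊕ w) ≡ toList v ++ toList w
toList-⊕ v ε       = sym (++-identityʳ (toList v))
toList-⊕ v (w ▷ x) = trans (cong (_++ x ∷ []) (toList-⊕ v w)) (++-assoc (toList v) (toList w) (x ∷ []))

toList-postWord : ∀ t → toList (postWord t) ≡ post t
toList-postWord lf         = refl
toList-postWord (ptr j)    = refl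
toList-postWord (node l r) = begin
  toList (postWord l ⊕ postWord r) ++ intN ∷ []
    ≡⟨ cong (_++ intN ∷ []) (trans (toList-⊕ (postWord l) (postWord r))
                                   (cong₂ _++_ (toList-postWord l) (toList-postWord r))) ⟩
  (post l ++ post r) ++ intN ∷ []
    ≡⟨ ++-assoc (post l) (post r) (intN ∷ []) ⟩
  post l ++ post r ++ intN ∷ [] ∎
  where open ≡-Reasoning

length-toList : ∀ w → length (toList w) ≡ len w
length-toList ε       = refl
length-toList (w ▷ x) = trans (length-++ (toList w)) (trans (+-comm (length (toList w)) 1) (cong suc (length-toList w)))

-- T of a conjunction, with the first boolean given explicitly so that it
-- can be used on stuck terms.
T-∧ˡ : ∀ a {b} → T (a ∧ b) → T a
T-∧ˡ true _ = tt

T-∧ʳ : ∀ a {b} → T (a ∧ b) → T b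
T-∧ʳ true t = t

T-∧-intro : ∀ {a b} → T a → T b → T (a ∧ b)
T-∧-intro {true} _ t = t

<ᵇ-true : ∀ {j k} → j < k → (j <ᵇ k) ≡ true
<ᵇ-true j<k = Equivalence.to T-≡ (<⇒<ᵇ j<k)

legal : Word → ℕ → Bool
legal w j = (j <ᵇ len w) ∧ legalTarget (toList w) j

-- The local condition checkFrom imposes on a node appended to w.
fits : Word → Node → Bool
fits w       (ptrN j) = legal w j
fits ε       lfN      = true
fits ε       intN     = false
fits (_ ▷ _) lfN      = false
fits (_ ▷ _) intN     = true

wellFormed : Word → Bool
wellFormed ε       = true
wellFormed (w ▷ x) = wellFormed w ∧ fits w x

checkFrom-++ : ∀ ps i xs ys → checkFrom ps i (xs ++ ys) ≡ checkFrom ps i xs ∧ checkFrom ps (i + length xs) ys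
checkFrom-++ ps i [] ys rewrite +-identityʳ i = refl
checkFrom-++ ps zero    (lfN    ∷ xs) ys = checkFrom-++ ps 1 xs ys
checkFrom-++ ps zero    (ptrN _ ∷ xs) ys = refl
checkFrom-++ ps zero    (intN   ∷ xs) ys = refl
checkFrom-++ ps (suc i) (lfN    ∷ xs) ys = refl
checkFrom-++ ps (suc i) (intN   ∷ xs) ys rewrite +-suc i (length xs) = checkFrom-++ ps (suc (suc i)) xs ys
checkFrom-++ ps (suc i) (ptrN j ∷ xs) ys rewrite +-suc i (length xs) | checkFrom-++ ps (suc (suc i)) xs ys =
  sym (trans (∧-assoc (j <ᵇ suc i) _ _) (cong ((j <ᵇ suc i) ∧_) (∧-assoc (legalTarget ps j) _ _)))

isInternalAt-++ : ∀ xs zs j → j < length xs → isInternalAt (xs ++ zs) j ≡ isInternalAt xs j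
isInternalAt-++ (lfN    ∷ xs) zs zero    _         = refl
isInternalAt-++ (ptrN _ ∷ xs) zs zero    _         = refl
isInternalAt-++ (intN   ∷ xs) zs zero    _         = refl
isInternalAt-++ (lfN    ∷ xs) zs (suc j) (s≤s j<) = isInternalAt-++ xs zs j j<
isInternalAt-++ (ptrN _ ∷ xs) zs (suc j) (s≤s j<) = isInternalAt-++ xs zs j j<
isInternalAt-++ (intN   ∷ xs) zs (suc j) (s≤s j<) = isInternalAt-++ xs zs j j<

isInternalAt-last : ∀ xs x → isInternalAt (xs ++ x ∷ []) (length xs) ≡ isInternalAt (x ∷ []) 0
isInternalAt-last []            x = refl
isInternalAt-last (lfN    ∷ xs) x = isInternalAt-last xs x
isInternalAt-last (ptrN _ ∷ xs) x = isInternalAt-last xs x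
isInternalAt-last (intN   ∷ xs) x = isInternalAt-last xs x

legal-++ : ∀ w zs j → ((j <ᵇ len w) ∧ legalTarget (toList w ++ zs) j) ≡ legal w j
legal-++ w zs j with j <ᵇ len w | <ᵇ-reflects-< j (len w)
... | false | _     = refl
... | true  | ofʸ j< rewrite isInternalAt-++ (toList w) zs j (subst (j <_) (sym (length-toList w)) j<) = refl

fits-checkFrom : ∀ w zs x → checkFrom (toList w ++ zs) (len w) (x ∷ []) ≡ fits w x
fits-checkFrom ε       zs lfN      = refl
fits-checkFrom ε       zs intN     = refl
fits-checkFrom ε       zs (ptrN j) = refl
fits-checkFrom (w ▷ y) zs lfN      = refl
fits-checkFrom (w ▷ y) zs intN     = refl
fits-checkFrom (w ▷ y) zs (ptrN j) =
  trans (cong ((j <ᵇ suc (len w)) ∧_) (∧-identityʳ _)) (legal-++ (w ▷ y) zs j)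

checkFrom-prefix : ∀ w zs → checkFrom (toList w ++ zs) 0 (toList w) ≡ wellFormed w
checkFrom-prefix ε       zs = refl
checkFrom-prefix (w ▷ x) zs = begin
  checkFrom ((toList w ++ x ∷ []) ++ zs) 0 (toList w ++ x ∷ [])
    ≡⟨ cong (λ ps → checkFrom ps 0 (toList w ++ x ∷ [])) (++-assoc (toList w) (x ∷ []) zs) ⟩
  checkFrom ps 0 (toList w ++ x ∷ [])
    ≡⟨ checkFrom-++ ps 0 (toList w) (x ∷ []) ⟩
  checkFrom ps 0 (toList w) ∧ checkFrom ps (length (toList w)) (x ∷ [])
    ≡⟨ cong (λ i → checkFrom ps 0 (toList w) ∧ checkFrom ps i (x ∷ [])) (length-toList w) ⟩
  checkFrom ps 0 (toList w) ∧ checkFrom ps (len w) (x ∷ [])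
    ≡⟨ cong₂ _∧_ (checkFrom-prefix w (x ∷ zs)) (fits-checkFrom w (x ∷ zs) x) ⟩
  wellFormed w ∧ fits w x ∎
  where
  open ≡-Reasoning
  ps : List Node
  ps = toList w ++ x ∷ zs

valid≡wellFormed : ∀ t → valid t ≡ wellFormed (postWord t)
valid≡wellFormed t = begin
  checkFrom (post t) 0 (post t)
    ≡⟨ cong (λ ps → checkFrom ps 0 ps) (sym (toList-postWord t)) ⟩
  checkFrom (toList w) 0 (toList w)
    ≡⟨ cong (λ ps → checkFrom ps 0 (toList w)) (sym (++-identityʳ (toList w))) ⟩
  checkFrom (toList w ++ []) 0 (toList w)
    ≡⟨ checkFrom-prefix w [] ⟩
  wellFormed w ∎
  where
  open ≡-Reasoning
  w : Word
  w = postWord t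

wellFormed-⊕ˡ : ∀ v u → T (wellFormed (v ⊕ u)) → T (wellFormed v)
wellFormed-⊕ˡ v ε       wf = wf
wellFormed-⊕ˡ v (u ▷ x) wf = wellFormed-⊕ˡ v u (T-∧ˡ (wellFormed (v ⊕ u)) wf)

-- Prefix w a b: w is a well-formed postorder prefix with a leaves and b
-- internal nodes.  Read as a stack machine, w leaves a - b trees on the
-- stack; an internal node needs two of them, i.e. b + 2 ≤ a.
data Prefix : Word → ℕ → ℕ → Set where
  empty    : Prefix ε 0 0
  leftmost : Prefix (ε ▷ lfN) 1 0
  pointer  : ∀ {w x y j} → Prefix w (suc x) y → T (legal w j) → Prefix (w ▷ ptrN j) (suc (suc x)) y
  internal : ∀ {w x y} → Prefix w (suc x) y → suc y ≤ x → Prefix (w ▷ intN) (suc x) (suc y)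

prefix-irrelevant : ∀ {w a b} (p q : Prefix w a b) → p ≡ q
prefix-irrelevant empty          empty            = refl
prefix-irrelevant leftmost       leftmost         = refl
prefix-irrelevant (pointer p l)  (pointer q l′)   = cong₂ pointer (prefix-irrelevant p q) (T-irrelevant l l′)
prefix-irrelevant (internal p h) (internal q h′)  = cong₂ internal (prefix-irrelevant p q) (≤-irrelevant h h′)

prefix-wellFormed : ∀ {w a b} → Prefix w a b → T (wellFormed w)
prefix-wellFormed empty          = tt
prefix-wellFormed leftmost       = tt
prefix-wellFormed (pointer p l)  = T-∧-intro (prefix-wellFormed p) l
prefix-wellFormed (internal p _) = T-∧-intro (prefix-wellFormed p) (internal-fits p)
  where
  internal-fits : ∀ {w x y} → Prefix w (suc x) y → T (fits w intN)
  internal-fits leftmost       = tt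
  internal-fits (pointer _ _)  = tt
  internal-fits (internal _ _) = tt

-- The stack is never of negative height.
internals≤leaves : ∀ {w a b} → Prefix w a b → b ≤ a
internals≤leaves empty          = z≤n
internals≤leaves leftmost       = z≤n
internals≤leaves (pointer p _)  = m≤n⇒m≤1+n (internals≤leaves p)
internals≤leaves (internal _ h) = s≤s (<⇒≤ h)

castPrefix : ∀ {w w′ a a′ b b′} → w ≡ w′ → a ≡ a′ → b ≡ b′ → Prefix w a b → Prefix w′ a′ b′
castPrefix refl refl refl p = p

extend : ∀ t {w a b} → Prefix w a b → T (wellFormed (w ⊕ postWord t)) →
         Prefix (w ⊕ postWord t) (suc (size t) + a) (size t + b)
extend lf         empty          _  = leftmost
extend lf         {w ▷ y}    _   wf = ⊥-elim (T-∧ʳ (wellFormed (w ▷ y)) wf)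
extend (ptr j)    empty          ()
extend (ptr j)    {w} {suc x} p  wf = pointer p (T-∧ʳ (wellFormed w) wf)
extend (node l r) {w} {a} {b}  p wf =
  internal (castPrefix (sym (⊕-assoc w (postWord l) (postWord r))) (leaves (size l) (size r) a) (internals (size l) (size r) b) both)
           (s≤s (+-monoʳ-≤ (size l + size r) (internals≤leaves p)))
  where
  wf-lr : T (wellFormed ((w ⊕ postWord l) ⊕ postWord r))
  wf-lr = subst (T ∘ wellFormed) (⊕-assoc w (postWord l) (postWord r))
                (T-∧ˡ (wellFormed (w ⊕ (postWord l ⊕ postWord r))) wf)
  both : Prefix ((w ⊕ postWord l) ⊕ postWord r) (suc (size r) + (suc (size l) + a)) (size r + (size l + b))
  both = extend r (extend l p (wellFormed-⊕ˡ (w ⊕ postWord l) (postWord r) wf-lr)) wf-lr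
  leaves : ∀ m n k → suc n + (suc m + k) ≡ suc (suc (m + n + k))
  leaves = solve-∀
  internals : ∀ m n k → n + (m + k) ≡ m + n + k
  internals = solve-∀

-- The word of a stack of trees (top first): their postorders, bottom to top.
stackWord : List DTree → Word
stackWord []      = ε
stackWord (t ∷ s) = stackWord s ⊕ postWord t

totalSize : List DTree → ℕ
totalSize []      = 0
totalSize (t ∷ s) = size t + totalSize s

prefix-stack : ∀ {w a b} → Prefix w a b →
               Σ (List DTree) λ s → (w ≡ stackWord s) × (length s + b ≡ a) × (totalSize s ≡ b)
prefix-stack empty    = [] , refl , refl , refl
prefix-stack leftmost = lf ∷ [] , refl , refl , refl
prefix-stack (pointer {j = j} p _) with prefix-stack p
... | s , w≡ , height , sizes = ptr j ∷ s , cong (_▷ ptrN j) w≡ , cong suc height , sizes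
prefix-stack (internal {x = x} {y} p h) with prefix-stack p
... | []          , _  , height , _ = ⊥-elim (1+n≰n (≤-trans (n≤1+n (suc x)) (subst (λ k → suc k ≤ x) height h)))
... | _ ∷ []      , _  , height , _ = ⊥-elim (1+n≰n (subst (λ k → suc k ≤ x) (suc-injective height) h))
... | t₂ ∷ t₁ ∷ s , w≡ , height , sizes =
  node t₁ t₂ ∷ s ,
  cong (_▷ intN) (trans w≡ (sym (⊕-assoc (stackWord s) (postWord t₁) (postWord t₂)))) ,
  trans (cong suc (+-suc (length s) y)) height ,
  cong suc (trans (cong (_+ totalSize s) (+-comm (size t₁) (size t₂)))
                  (trans (+-assoc (size t₂) (size t₁) (totalSize s)) sizes))

prefix-tree : ∀ {w n} → Prefix w (suc n) n → Σ DTree λ t → (w ≡ postWord t) × (size t ≡ n)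
prefix-tree {n = n} p with prefix-stack p
... | []         , _  , height , _     = ⊥-elim (1+n≢n (sym height))
... | t ∷ []     , w≡ , _      , sizes = t , trans w≡ (ε-⊕ (postWord t)) , trans (sym (+-identityʳ (size t))) sizes
... | _ ∷ _ ∷ s  , _  , height , _     =
  ⊥-elim (1+n≰n (subst (suc n ≤_) (suc-injective height) (s≤s (m≤n+m n (length s)))))

-- Running the stack machine on a word; it recovers the trees of a postorder.
push : Maybe (List DTree) → Node → Maybe (List DTree)
push nothing                 _        = nothing
push (just s)                lfN      = just (lf ∷ s)
push (just s)                (ptrN j) = just (ptr j ∷ s)
push (just (t₂ ∷ t₁ ∷ s))    intN     = just (node t₁ t₂ ∷ s)
push (just _)                intN     = nothing

parse : Word → Maybe (List DTree)
parse ε       = just []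
parse (w ▷ x) = push (parse w) x

parse-postWord : ∀ t {w s} → parse w ≡ just s → parse (w ⊕ postWord t) ≡ just (t ∷ s)
parse-postWord lf      e rewrite e = refl
parse-postWord (ptr j) e rewrite e = refl
parse-postWord (node l r) {w} e = cong (λ m → push m intN)
  (trans (cong parse (⊕-assoc w (postWord l) (postWord r))) (parse-postWord r (parse-postWord l e)))

postWord-injective : ∀ t t′ → postWord t ≡ postWord t′ → t ≡ t′
postWord-injective t t′ e = single-injective (trans (sym (parse-single t)) (trans (cong parse e) (parse-single t′)))
  where
  parse-single : ∀ u → parse (postWord u) ≡ just (u ∷ [])
  parse-single u = subst (λ v → parse v ≡ just (u ∷ [])) (ε-⊕ (postWord u)) (parse-postWord u refl)
  single-injective : ∀ {u v} → just (u ∷ []) ≡ just (v ∷ []) → u ≡ v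
  single-injective refl = refl

-- Prefixes with the left-most leaf, x pointers and y internal nodes.
Prefixes : ℕ → ℕ → Set
Prefixes x y = Σ Word (λ w → Prefix w (suc x) y)

prefixes-≡ : ∀ {x y} (u v : Prefixes x y) → proj₁ u ≡ proj₁ v → u ≡ v
prefixes-≡ (w , p) (.w , q) refl = cong (w ,_) (prefix-irrelevant p q)

relaxedTree-≡ : ∀ {n} (u v : RelaxedTree n) → proj₁ u ≡ proj₁ v → u ≡ v
relaxedTree-≡ (t , s , v) (.t , s′ , v′) refl = cong₂ (λ a b → t , a , b) (≡-irrelevant s s′) (T-irrelevant v v′)

validTree-prefix : ∀ t → T (valid t) → Prefix (postWord t) (suc (size t)) (size t)
validTree-prefix t v =
  castPrefix (ε-⊕ (postWord t)) (cong suc (+-identityʳ (size t))) (+-identityʳ (size t))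
    (extend t empty (subst (T ∘ wellFormed) (sym (ε-⊕ (postWord t))) (subst T (valid≡wellFormed t) v)))

prefixes↔trees : ∀ n → Prefixes n n ↔ RelaxedTree n
prefixes↔trees n = mk↔ₛ′ toTree fromTree toTree-fromTree fromTree-toTree
  where
  toTree : Prefixes n n → RelaxedTree n
  toTree (w , p) =
    let (t , w≡t , sized) = prefix-tree p
    in t , sized , subst T (sym (valid≡wellFormed t)) (subst (T ∘ wellFormed) w≡t (prefix-wellFormed p))
  fromTree : RelaxedTree n → Prefixes n n
  fromTree (t , sized , v) = postWord t , subst (λ k → Prefix (postWord t) (suc k) k) sized (validTree-prefix t v)
  toTree-fromTree : ∀ q → toTree (fromTree q) ≡ q
  toTree-fromTree q = relaxedTree-≡ _ q (postWord-injective _ _ (sym (proj₁ (proj₂ (prefix-tree (proj₂ (fromTree q)))))))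
  fromTree-toTree : ∀ p → fromTree (toTree p) ≡ p
  fromTree-toTree p = prefixes-≡ _ p (sym (proj₁ (proj₂ (prefix-tree (proj₂ p)))))

-- Pointer targets: after y internal nodes there are y + 1 of them

Target : Word → Set
Target w = Σ ℕ (λ j → T (legal w j))

target-≡ : ∀ w {j j′} {l : T (legal w j)} {l′ : T (legal w j′)} → j ≡ j′ → (j , l) ≡ (j′ , l′)
target-≡ w {l = l} {l′} refl = cong (_ ,_) (T-irrelevant l l′)

legal-< : ∀ w {j} → T (legal w j) → j < len w
legal-< w {j} l = <ᵇ⇒< j (len w) (T-∧ˡ (j <ᵇ len w) l)

legal-snoc : ∀ w x j → j < len w → legal (w ▷ x) j ≡ legal w j
legal-snoc w x j j< = begin
  (j <ᵇ suc (len w)) ∧ legalTarget (toList w ++ x ∷ []) j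
    ≡⟨ cong (_∧ legalTarget (toList w ++ x ∷ []) j) (trans (<ᵇ-true (m<n⇒m<1+n j<)) (sym (<ᵇ-true j<))) ⟩
  (j <ᵇ len w) ∧ legalTarget (toList w ++ x ∷ []) j
    ≡⟨ legal-++ w (x ∷ []) j ⟩
  legal w j ∎
  where open ≡-Reasoning

legal-above : ∀ w x {j} → T (legal w j) → T (legal (w ▷ x) j)
legal-above w x {j} l = subst T (sym (legal-snoc w x j (legal-< w l))) l

legal-below : ∀ w x {j} → T (legal (w ▷ x) j) → j ≢ len w → T (legal w j)
legal-below w x {j} l j≢ = subst T (legal-snoc w x j (≤∧≢⇒< (s≤s⁻¹ (legal-< (w ▷ x) l)) j≢)) l

legal-new : ∀ w x → legal (w ▷ x) (len w) ≡ (len w ≡ᵇ 0) ∨ isInternalAt (x ∷ []) 0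
legal-new w x = begin
  (len w <ᵇ suc (len w)) ∧ legalTarget (toList w ++ x ∷ []) (len w)
    ≡⟨ cong (_∧ legalTarget (toList w ++ x ∷ []) (len w)) (<ᵇ-true (n<1+n (len w))) ⟩
  (len w ≡ᵇ 0) ∨ isInternalAt (toList w ++ x ∷ []) (len w)
    ≡⟨ cong (λ i → (len w ≡ᵇ 0) ∨ isInternalAt (toList w ++ x ∷ []) i) (sym (length-toList w)) ⟩
  (len w ≡ᵇ 0) ∨ isInternalAt (toList w ++ x ∷ []) (length (toList w))
    ≡⟨ cong ((len w ≡ᵇ 0) ∨_) (isInternalAt-last (toList w) x) ⟩
  (len w ≡ᵇ 0) ∨ isInternalAt (x ∷ []) 0 ∎
  where open ≡-Reasoning

legal-new-pointer : ∀ w k → 1 ≤ len w → legal (w ▷ ptrN k) (len w) ≡ false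
legal-new-pointer (w ▷ y) k _ = legal-new (w ▷ y) (ptrN k)

targets-leftmost : ⊤ ↔ Target (ε ▷ lfN)
targets-leftmost = mk↔ₛ′ (λ _ → 0 , tt) (λ _ → tt) (λ (j , l) → target-≡ (ε ▷ lfN) (sym (n<1⇒n≡0 (legal-< (ε ▷ lfN) l)))) (λ _ → refl)

targets-pointer : ∀ w k → 1 ≤ len w → Target w ↔ Target (w ▷ ptrN k)
targets-pointer w k nonempty = mk↔ₛ′ up down (λ _ → target-≡ (w ▷ ptrN k) refl) (λ _ → target-≡ w refl)
  where
  up : Target w → Target (w ▷ ptrN k)
  up (j , l) = j , legal-above w (ptrN k) l
  down : Target (w ▷ ptrN k) → Target w
  down (j , l) = j , legal-below w (ptrN k) l (λ { refl → subst T (legal-new-pointer w k nonempty) l })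

targets-internal : ∀ w → (⊤ ⊎ Target w) ↔ Target (w ▷ intN)
targets-internal w = mk↔ₛ′ to from to-from from-to
  where
  new : Target (w ▷ intN)
  new = len w , subst T (sym (trans (legal-new w intN) (∨-zeroʳ (len w ≡ᵇ 0)))) tt
  to : ⊤ ⊎ Target w → Target (w ▷ intN)
  to (inj₁ _)       = new
  to (inj₂ (j , l)) = j , legal-above w intN l
  from : Target (w ▷ intN) → ⊤ ⊎ Target w
  from (j , l) with j ≟ len w
  ... | yes _  = inj₁ tt
  ... | no j≢  = inj₂ (j , legal-below w intN l j≢)
  to-from : ∀ q → to (from q) ≡ q
  to-from (j , l) with j ≟ len w
  ... | yes j≡ = target-≡ (w ▷ intN) (sym j≡)
  ... | no _   = target-≡ (w ▷ intN) refl
  from-to : ∀ q → from (to q) ≡ q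
  from-to (inj₁ _) with len w ≟ len w
  ... | yes _  = refl
  ... | no ≢   = ⊥-elim (≢ refl)
  from-to (inj₂ (j , l)) with j ≟ len w
  ... | yes j≡ = ⊥-elim (<-irrefl j≡ (legal-< w l))
  ... | no _   = cong inj₂ (target-≡ w refl)

prefix-nonempty : ∀ {w x y} → Prefix w (suc x) y → 1 ≤ len w
prefix-nonempty leftmost       = s≤s z≤n
prefix-nonempty (pointer _ _)  = s≤s z≤n
prefix-nonempty (internal _ _) = s≤s z≤n

Fin-suc : ∀ {n} → Fin (suc n) ↔ (⊤ ⊎ Fin n)
Fin-suc = ↔-trans (+↔⊎ {1}) (1↔⊤ ⊎-↔ ↔-refl)

-- After a prefix with y internal nodes there are exactly y+1 targets:
-- the left-most leaf and the internal nodes.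
targets : ∀ {w x y} → Prefix w (suc x) y → Fin (suc y) ↔ Target w
targets leftmost              = ↔-trans 1↔⊤ targets-leftmost
targets (pointer {j = k} p _) = ↔-trans (targets p) (targets-pointer _ k (prefix-nonempty p))
targets (internal p _)        = ↔-trans Fin-suc (↔-trans (↔-refl ⊎-↔ targets p) (targets-internal _))

-- Decorated paths are prefixes

-- An H step with decoration d appends a pointer to the d-th target.
appendPointer : ∀ {x y} → Prefixes x y → Fin (suc y) → Prefixes (suc x) y
appendPointer (w , p) d = w ▷ ptrN (proj₁ target) , pointer p (proj₂ target)
  where
  target : Target w
  target = Inverse.to (targets p) d

toPrefix : ∀ {x y} → HDPath x y → Prefixes x y
toPrefix start        = ε ▷ lfN , leftmost
toPrefix (stepH q d)  = appendPointer (toPrefix q) d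
toPrefix (stepV q le) = let (w , p) = toPrefix q in w ▷ intN , internal p le

toPath : ∀ {w x y} → Prefix w (suc x) y → HDPath x y
toPath leftmost              = start
toPath (pointer {j = j} p l) = stepH (toPath p) (Inverse.from (targets p) (j , l))
toPath (internal p le)       = stepV (toPath p) le

toPath-toPrefix : ∀ {x y} (q : HDPath x y) → toPath (proj₂ (toPrefix q)) ≡ q
toPath-toPrefix start = refl
toPath-toPrefix (stepH q d) with toPrefix q | toPath-toPrefix q
... | w , p | e = cong₂ stepH e (Inverse.strictlyInverseʳ (targets p) d)
toPath-toPrefix (stepV q le) with toPrefix q | toPath-toPrefix q
... | w , p | e = cong (λ q′ → stepV q′ le) e

toPrefix-toPath : ∀ {w x y} (p : Prefix w (suc x) y) → toPrefix (toPath p) ≡ (w , p)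
toPrefix-toPath leftmost = refl
toPrefix-toPath (pointer {w = v} {j = j} p l) with toPrefix (toPath p) | toPrefix-toPath p
... | _ | refl = cong (λ (t : Target v) → v ▷ ptrN (proj₁ t) , pointer p (proj₂ t))
                      (Inverse.strictlyInverseˡ (targets p) (j , l))
toPrefix-toPath (internal p le) with toPrefix (toPath p) | toPrefix-toPath p
... | _ | refl = refl

paths↔prefixes : ∀ x y → HDPath x y ↔ Prefixes x y
paths↔prefixes x y = mk↔ₛ′ toPrefix (toPath ∘ proj₂) (λ (w , p) → toPrefix-toPath p) toPath-toPrefix

proposition2p6 : Σ (ℕ → ℕ → ℕ) (λ r →
      (∀ n m → Fin (r n m) ↔ HDPath n m)
    × (∀ n m → 1 ≤ n → 1 ≤ m → m ≤ n → r n m ≡ r n (m ∸ 1) + (m + 1) * r (n ∸ 1) m)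
    × (∀ n m → n < m → r n m ≡ 0)
    × (∀ n → r n 0 ≡ 1)
    × (∀ n → Fin (r n n) ↔ RelaxedTree n))
proposition2p6 = r , r-counts , r-recurrence , r-zero-above-diagonal , r-horizontal-axis ,
  λ n → ↔-trans (r-counts n n) (↔-trans (paths↔prefixes n n) (prefixes↔trees n))
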